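{- Let $a,b$ be distinct relatively prime positive integers and let $\mathcal{U}=\mathcal{U}(a,b)$. Then: (i) for any integer $c>(b+1)a$, if $\{c,c+a,c+2a,\dots,c+ba\}\subset\mathcal{U}$, then $c+(b+1)a\notin\mathcal{U}$; (ii) for any integer $c>b(a+1)$, if $\{c,c+b,c+2b,\dots,c+ab\}\subset\mathcal{U}$, then $c+(a+1)b\notin\mathcal{U}$.
   Context: For distinct positive integers $a,b$, the Ulam sequence $\mathcal{U}(a,b)$ is the increasing sequence whose first two terms are $a$ and $b$ and in which each subsequent term is the smallest integer larger than all previous terms that can be written as the sum of two distinct earlier terms in exactly one way (unordered pairs). We identify the sequence with its set of terms. -}

module Defs where

open import Data.Nat using (ℕ; zero; suc; _+_; _∸_; _<ᵇ_; _≡ᵇ_; _⊔_)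
open import Data.Bool using (Bool; true; false; if_then_else_; _∧_; _∨_)
open import Data.List using (List; []; _∷_; _++_; upTo; map)
open import Relation.Binary.PropositionalEquality using (_≡_)

lookupB : List Bool → ℕ → Bool
lookupB []       _       = false
lookupB (x ∷ xs) zero    = x
lookupB (x ∷ xs) (suc i) = lookupB xs i

countB : (ℕ → Bool) → List ℕ → ℕ
countB p []       = 0
countB p (x ∷ xs) = if p x then suc (countB p xs) else countB p xs

reps : List Bool → ℕ → ℕ
reps tbl n = countB (λ x → ((x <ᵇ (n ∸ x)) ∧ lookupB tbl x) ∧ lookupB tbl (n ∸ x)) (upTo n)

-- Otherwise n is a term iff it is a sum of two distinct smaller terms in
-- exactly one way (all smaller terms are exactly the earlier terms,
-- since the sequence is increasing).
step : ℕ → ℕ → List Bool → ℕ → Bool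
step a b tbl n =
  if (n ≡ᵇ a) ∨ (n ≡ᵇ b) then true
  else if n <ᵇ suc (a ⊔ b) then false
  else (reps tbl n ≡ᵇ 1)

extend : ℕ → ℕ → ℕ → List Bool → List Bool
extend a b n tbl = tbl ++ (step a b tbl n ∷ [])

table : ℕ → ℕ → ℕ → List Bool
table a b zero    = []
table a b (suc n) = extend a b n (table a b n)

ulam? : ℕ → ℕ → ℕ → Bool
ulam? a b n = lookupB (table a b (suc n)) n

InUlam : ℕ → ℕ → ℕ → Set
InUlam a b n = ulam? a b n ≡ true

-- Every term of 𝒰(a,b) is a combination sa + tb, and for coprime a, b the coordinates
-- (s, t) of a small number are unique.  Comparing coordinates of the two parts of a sum
-- shows that jb ∉ 𝒰 for 2 ≤ j ≤ a, that a + kb ∈ 𝒰 for k < a (its only representation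
-- being b + (a + (k - 1)b)), and hence that (b + 1)a = b + (a + (a - 1)b) ∈ 𝒰.  So some
-- ka with 2 ≤ k ≤ b + 1 is a term (k = b when a = 1, and k = 2 when b = 1, since 𝒰(a,1)
-- contains a, …, 2a).  If c, c + a, …, c + ba are terms, then
-- c + (b + 1)a = a + (c + ba) = ka + (c + (b + 1 - k)a) has two representations.
-- Part (ii) is part (i) for 𝒰(b,a) = 𝒰(a,b).
{-# OPTIONS --safe #-}
module Submission where

open import Defs
open import Data.Nat using (ℕ; _+_; _*_; _<_; _≤_)
open import Data.Nat.Coprimality using (Coprime)
open import Data.Product using (_×_)
open import Relation.Nullary using (¬_)
open import Relation.Binary.PropositionalEquality using (_≢_)

open import Data.Bool using (Bool; true; false; if_then_else_; _∧_; T)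
open import Data.Bool.Properties using (∨-comm)
open import Data.Empty using (⊥; ⊥-elim)
open import Data.List using ([]; _∷_; _++_; upTo; length)
open import Data.List.Properties using (length-++; upTo-∷ʳ)
open import Data.Nat using (zero; suc; _∸_; _⊔_; _<ᵇ_; _≡ᵇ_; _≟_; _<?_; z≤n; s≤s; s≤s⁻¹; z<s; NonZero; >-nonZero)
open import Data.Nat.Coprimality using (coprime-divisor) renaming (sym to Coprime-sym)
open import Data.Nat.Divisibility using (_∣_; ∣-refl; ∣⇒≤; ∣m+n∣m⇒∣n; n∣m*n)
open import Data.Nat.Induction using (<-rec)
open import Data.Nat.Properties
open import Data.Nat.Tactic.RingSolver using (solve-∀)
open import Data.Product using (Σ; ∃; ∃₂; _,_; proj₁)
open import Data.Sum using (_⊎_; inj₁; inj₂)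
open import Function using (_∘_)
open import Relation.Binary.Definitions using (tri<; tri≈; tri>)
open import Relation.Binary.PropositionalEquality using (_≡_; refl; sym; trans; cong; cong₂; subst; module ≡-Reasoning)
open import Relation.Nullary using (contradiction; yes; no)
open import Relation.Nullary.Decidable using (dec-true; dec-false)

coprime-shift≡0 : ∀ {a b} s t d v → Coprime a b → s * a + t * b ≡ (s + d) * a + v * b → d < b → d ≡ 0
coprime-shift≡0 s t zero    v cop eq d<b = refl
coprime-shift≡0 {a} {b} s t (suc d) v cop eq d<b = contradiction (∣⇒≤ b∣1+d) (<⇒≱ d<b)
  where
  t*b≡ : t * b ≡ v * b + suc d * a
  t*b≡ = +-cancelˡ-≡ (s * a) _ _ (trans eq (rearrange s (suc d) a v b))
    where
    rearrange : ∀ s e a v b → (s + e) * a + v * b ≡ s * a + (v * b + e * a)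
    rearrange = solve-∀
  b∣1+d : b ∣ suc d
  b∣1+d = coprime-divisor (Coprime-sym cop)
            (subst (b ∣_) (*-comm (suc d) a) (∣m+n∣m⇒∣n (subst (b ∣_) t*b≡ (n∣m*n t)) (n∣m*n v)))

coprime-coords-≤ : ∀ {a b s t u v} → Coprime a b → s * a + t * b ≡ u * a + v * b → s ≤ u → u < s + b → s ≡ u
coprime-coords-≤ {s = s} {t} {u} {v} cop eq s≤u u<s+b = ≤-antisym s≤u (m∸n≡0⇒m≤n u∸s≡0)
  where
  u≡s+[u∸s] : u ≡ s + (u ∸ s)
  u≡s+[u∸s] = sym (m+[n∸m]≡n s≤u)
  u∸s≡0 : u ∸ s ≡ 0
  u∸s≡0 = coprime-shift≡0 s t (u ∸ s) v cop (subst (λ w → _ ≡ w * _ + v * _) u≡s+[u∸s] eq)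
            (+-cancelˡ-< s (u ∸ s) _ (subst (_< s + _) u≡s+[u∸s] u<s+b))

coprime-coords : ∀ {a b s t u v} → Coprime a b → s * a + t * b ≡ u * a + v * b →
                 s < u + b → u < s + b → s ≡ u
coprime-coords {s = s} {t} {u} {v} cop eq s<u+b u<s+b with ≤-total s u
... | inj₁ s≤u = coprime-coords-≤ {t = t} {v = v} cop eq s≤u u<s+b
... | inj₂ u≤s = sym (coprime-coords-≤ {t = v} {v = t} cop (sym eq) u≤s s<u+b)

combination-cancel : ∀ {a b s t u v} .{{_ : NonZero b}} → s * a + t * b ≡ u * a + v * b → s ≡ u → t ≡ v
combination-cancel {a} {b} {s} {t} {v = v} eq refl = *-cancelʳ-≡ t v b (+-cancelˡ-≡ (s * a) _ _ eq)

≢⇒≡ᵇ-false : ∀ {m n} → m ≢ n → (m ≡ᵇ n) ≡ false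
≢⇒≡ᵇ-false {m} {n} = dec-false (m ≟ n)

≡ᵇ-refl : ∀ m → (m ≡ᵇ m) ≡ true
≡ᵇ-refl m = dec-true (m ≟ m) refl

<⇒<ᵇ-true : ∀ {m n} → m < n → (m <ᵇ n) ≡ true
<⇒<ᵇ-true {m} {n} = dec-true (m <? n)

∧-true : ∀ {p q} → p ∧ q ≡ true → p ≡ true × q ≡ true
∧-true {true} {true} refl = refl , refl

true-∧-true : ∀ {p q} → p ≡ true → q ≡ true → p ∧ q ≡ true
true-∧-true refl refl = refl

lookupB-++ˡ : ∀ xs ys {i} → i < length xs → lookupB (xs ++ ys) i ≡ lookupB xs i
lookupB-++ˡ (x ∷ xs) ys {zero}  _         = refl
lookupB-++ˡ (x ∷ xs) ys {suc i} (s≤s i<n) = lookupB-++ˡ xs ys i<n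

lookupB-++-length : ∀ xs y ys → lookupB (xs ++ y ∷ ys) (length xs) ≡ y
lookupB-++-length []       y ys = refl
lookupB-++-length (x ∷ xs) y ys = lookupB-++-length xs y ys

length-table : ∀ a b n → length (table a b n) ≡ n
length-table a b zero    = refl
length-table a b (suc n) = begin
  length (table a b n ++ _ ∷ [])  ≡⟨ length-++ (table a b n) ⟩
  length (table a b n) + 1        ≡⟨ cong (_+ 1) (length-table a b n) ⟩
  n + 1                           ≡⟨ +-comm n 1 ⟩
  suc n                           ∎
  where open ≡-Reasoning

lookupB-table : ∀ a b {n x} → x < n → lookupB (table a b n) x ≡ ulam? a b x
lookupB-table a b {suc n} {x} (s≤s x≤n) with m≤n⇒m<n∨m≡n x≤n
... | inj₁ x<n = trans (lookupB-++ˡ (table a b n) _ (subst (x <_) (sym (length-table a b n)) x<n))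
                       (lookupB-table a b x<n)
... | inj₂ refl = refl

ulam?-step : ∀ a b n → ulam? a b n ≡ step a b (table a b n) n
ulam?-step a b n = trans (cong (lookupB (table a b (suc n))) (sym (length-table a b n)))
                         (lookupB-++-length (table a b n) _ [])

table-swap : ∀ a b n → table a b n ≡ table b a n
table-swap a b zero    = refl
table-swap a b (suc n) rewrite table-swap a b n | ∨-comm (n ≡ᵇ a) (n ≡ᵇ b) | ⊔-comm a b = refl

InUlam-swap : ∀ {a b} n → InUlam a b n → InUlam b a n
InUlam-swap {a} {b} n = subst (λ t → lookupB t n ≡ true) (table-swap a b (suc n))

generator₁-∈ : ∀ a b → InUlam a b a
generator₁-∈ a b rewrite ulam?-step a b a | ≡ᵇ-refl a = refl

generator₂-∈ : ∀ a b → InUlam a b b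
generator₂-∈ a b = InUlam-swap b (generator₁-∈ b a)

0∉ : ∀ {a b} → 0 < a → 0 < b → ¬ InUlam a b 0
0∉ {suc a} {suc b} _ _ ()

module _ (p : ℕ → Bool) where

  countB-∷ʳ : ∀ xs y → countB p (xs ++ y ∷ []) ≡ countB p xs + (if p y then 1 else 0)
  countB-∷ʳ [] y with p y
  ... | true  = refl
  ... | false = refl
  countB-∷ʳ (x ∷ xs) y with p x
  ... | true  = cong suc (countB-∷ʳ xs y)
  ... | false = countB-∷ʳ xs y

  countB-upTo-suc : ∀ n → countB p (upTo (suc n)) ≡ countB p (upTo n) + (if p n then 1 else 0)
  countB-upTo-suc n = trans (cong (countB p) (sym (upTo-∷ʳ n))) (countB-∷ʳ (upTo n) n)

  countB-upTo-≡0 : ∀ n → (∀ {x} → x < n → p x ≡ false) → countB p (upTo n) ≡ 0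
  countB-upTo-≡0 zero    _    = refl
  countB-upTo-≡0 (suc n) none rewrite countB-upTo-suc n | none (n<1+n n)
    | countB-upTo-≡0 n (λ x<n → none (m<n⇒m<1+n x<n)) = refl

  countB-upTo-≡1 : ∀ {n x₀} → x₀ < n → p x₀ ≡ true → (∀ {x} → x < n → p x ≡ true → x ≡ x₀) →
                   countB p (upTo n) ≡ 1
  countB-upTo-≡1 {suc n} {x₀} (s≤s x₀≤n) px₀ only rewrite countB-upTo-suc n
    with m≤n⇒m<n∨m≡n x₀≤n
  ... | inj₂ refl rewrite px₀ = cong (_+ 1) (countB-upTo-≡0 n none)
    where
    none : ∀ {x} → x < n → p x ≡ false
    none {x} x<n with p x in px
    ... | true  = contradiction (only (m<n⇒m<1+n x<n) px) (<⇒≢ x<n)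
    ... | false = refl
  ... | inj₁ x₀<n with p n in pn
  ...   | true  = contradiction (only (n<1+n n) pn) (>⇒≢ x₀<n)
  ...   | false = trans (+-identityʳ _)
                        (countB-upTo-≡1 x₀<n px₀ (λ x<n → only (m<n⇒m<1+n x<n)))

  countB-upTo-witness : ∀ n → 1 ≤ countB p (upTo n) → ∃ λ x → x < n × p x ≡ true
  countB-upTo-witness (suc n) c rewrite countB-upTo-suc n with p n in pn
  ... | true  = n , n<1+n n , pn
  ... | false with countB-upTo-witness n (subst (1 ≤_) (+-identityʳ _) c)
  ...   | x , x<n , px = x , m<n⇒m<1+n x<n , px

  countB-upTo-≥1 : ∀ {n x} → x < n → p x ≡ true → 1 ≤ countB p (upTo n)
  countB-upTo-≥1 {suc n} {x} (s≤s x≤n) px rewrite countB-upTo-suc n with m≤n⇒m<n∨m≡n x≤n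
  ... | inj₁ x<n  = ≤-trans (countB-upTo-≥1 x<n px) (m≤m+n _ _)
  ... | inj₂ refl rewrite px = m≤n+m 1 _

  countB-upTo-≥2 : ∀ {n x₀ x₁} → x₀ < x₁ → x₁ < n → p x₀ ≡ true → p x₁ ≡ true →
                   2 ≤ countB p (upTo n)
  countB-upTo-≥2 {suc n} {x₀} {x₁} x₀<x₁ (s≤s x₁≤n) px₀ px₁ rewrite countB-upTo-suc n
    with m≤n⇒m<n∨m≡n x₁≤n
  ... | inj₁ x₁<n = ≤-trans (countB-upTo-≥2 x₀<x₁ x₁<n px₀ px₁) (m≤m+n _ _)
  ... | inj₂ refl rewrite px₁ = +-monoˡ-≤ 1 (countB-upTo-≥1 x₀<x₁ px₀)

record Split (a b n : ℕ) : Set where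
  constructor split
  field
    small large : ℕ
    small<large : small < large
    small+large : small + large ≡ n
    small∈      : InUlam a b small
    large∈      : InUlam a b large

open Split

small<sum : ∀ {a b n} (s : Split a b n) → small s < n
small<sum s = subst (small s <_) (small+large s) (<-≤-trans (small<large s) (m≤n+m (large s) (small s)))

sum∸small≡large : ∀ {a b n} (s : Split a b n) → n ∸ small s ≡ large s
sum∸small≡large s = trans (cong (_∸ small s) (sym (small+large s))) (m+n∸m≡n (small s) (large s))

Split-swap : ∀ {a b n} → Split a b n → Split b a n
Split-swap (split x y x<y x+y x∈ y∈) = split x y x<y x+y (InUlam-swap x x∈) (InUlam-swap y y∈)

IsPart : ∀ {a b n} → Split a b n → ℕ → Set
IsPart s p = small s ≡ p ⊎ large s ≡ p

small≢other-large : ∀ {a b n} (s t : Split a b n) → small s ≢ large t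
small≢other-large s t sₛ≡lₜ = <-irrefl refl (begin-strict
  small s  <⟨ small<large s ⟩
  large s  ≡⟨ lₛ≡sₜ ⟩
  small t  <⟨ small<large t ⟩
  large t  ≡⟨ sym sₛ≡lₜ ⟩
  small s  ∎)
  where
  open ≤-Reasoning
  lₛ≡sₜ : large s ≡ small t
  lₛ≡sₜ = +-cancelˡ-≡ (small s) _ _ (begin-equality
    small s + large s  ≡⟨ trans (small+large s) (sym (small+large t)) ⟩
    small t + large t  ≡⟨ cong (small t +_) (sym sₛ≡lₜ) ⟩
    small t + small s  ≡⟨ +-comm (small t) (small s) ⟩
    small s + small t  ∎)

small-unique-by-part : ∀ {a b n p} (s t : Split a b n) → IsPart s p → IsPart t p → small s ≡ small t
small-unique-by-part s t (inj₁ sₛ≡p) (inj₁ sₜ≡p) = trans sₛ≡p (sym sₜ≡p)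
small-unique-by-part s t (inj₂ lₛ≡p) (inj₂ lₜ≡p) =
  +-cancelʳ-≡ (large s) (small s) (small t)
    (trans (small+large s) (trans (sym (small+large t)) (cong (small t +_) (trans lₜ≡p (sym lₛ≡p)))))
small-unique-by-part s t (inj₁ sₛ≡p) (inj₂ lₜ≡p) = contradiction (trans sₛ≡p (sym lₜ≡p)) (small≢other-large s t)
small-unique-by-part s t (inj₂ lₛ≡p) (inj₁ sₜ≡p) = contradiction (trans sₜ≡p (sym lₛ≡p)) (small≢other-large t s)

record Coords {a b n : ℕ} (sp : Split a b n) : Set where
  constructor coords
  field
    s₁ t₁ s₂ t₂ : ℕ
    small≡ : s₁ * a + t₁ * b ≡ small sp
    large≡ : s₂ * a + t₂ * b ≡ large sp

  sum≡ : (s₁ + s₂) * a + (t₁ + t₂) * b ≡ n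
  sum≡ = begin
    (s₁ + s₂) * a + (t₁ + t₂) * b          ≡⟨ regroup s₁ t₁ s₂ t₂ a b ⟩
    (s₁ * a + t₁ * b) + (s₂ * a + t₂ * b)  ≡⟨ cong₂ _+_ small≡ large≡ ⟩
    small sp + large sp                    ≡⟨ small+large sp ⟩
    n                                      ∎
    where
    open ≡-Reasoning
    regroup : ∀ s₁ t₁ s₂ t₂ a b → (s₁ + s₂) * a + (t₁ + t₂) * b ≡ (s₁ * a + t₁ * b) + (s₂ * a + t₂ * b)
    regroup = solve-∀

Coords-swap : ∀ {a b n} {sp : Split a b n} → Coords sp → Coords (Split-swap sp)
Coords-swap {a} {b} (coords s₁ t₁ s₂ t₂ small≡ large≡) =
  coords t₁ s₁ t₂ s₂ (trans (+-comm (t₁ * b) (s₁ * a)) small≡) (trans (+-comm (t₂ * b) (s₂ * a)) large≡)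

-- The test counted by reps (table a b n) n.
smallerSummand? : ℕ → ℕ → ℕ → ℕ → Bool
smallerSummand? a b n x = ((x <ᵇ (n ∸ x)) ∧ lookupB (table a b n) x) ∧ lookupB (table a b n) (n ∸ x)

ulam?-unfold : ∀ {a b n} → n ≢ a → n ≢ b →
  ulam? a b n ≡ (if n <ᵇ suc (a ⊔ b) then false else (countB (smallerSummand? a b n) (upTo n) ≡ᵇ 1))
ulam?-unfold {a} {b} {n} n≢a n≢b rewrite ulam?-step a b n | ≢⇒≡ᵇ-false n≢a | ≢⇒≡ᵇ-false n≢b = refl

module Membership {a b : ℕ} (0<a : 0 < a) (0<b : 0 < b) where

  ∈⇒>0 : ∀ {n} → InUlam a b n → 0 < n
  ∈⇒>0 {zero}  0∈ = contradiction 0∈ (0∉ 0<a 0<b)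
  ∈⇒>0 {suc n} _  = z<s

  smallerSummand?-sound : ∀ {n x} → smallerSummand? a b n x ≡ true → Σ (Split a b n) λ s → small s ≡ x
  smallerSummand?-sound {n} {x} test with ∧-true test
  ... | xy , y∈ with ∧-true xy
  ... | x<y , x∈ = split x (n ∸ x) x<n∸x (m+[n∸m]≡n (<⇒≤ x<n)) x∈′ n∸x∈ , refl
    where
    x<n∸x : x < n ∸ x
    x<n∸x = <ᵇ⇒< x (n ∸ x) (subst T (sym x<y) _)
    x<n : x < n
    x<n = <-≤-trans x<n∸x (m∸n≤m n x)
    x∈′ : InUlam a b x
    x∈′ = trans (sym (lookupB-table a b x<n)) x∈
    n∸x∈ : InUlam a b (n ∸ x)
    n∸x∈ = trans (sym (lookupB-table a b (∸-monoʳ-< (∈⇒>0 x∈′) (<⇒≤ x<n)))) y∈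

  large<sum : ∀ {n} (s : Split a b n) → large s < n
  large<sum s = subst (large s <_) (small+large s) (m<n+m (large s) (∈⇒>0 (small∈ s)))

  smallerSummand?-complete : ∀ {n} (s : Split a b n) → smallerSummand? a b n (small s) ≡ true
  smallerSummand?-complete {n} s rewrite sum∸small≡large s =
    true-∧-true (true-∧-true (<⇒<ᵇ-true (small<large s)) (lookup-∈ (small<sum s) (small∈ s)))
                (lookup-∈ (large<sum s) (large∈ s))
    where
    lookup-∈ : ∀ {x} → x < n → InUlam a b x → lookupB (table a b n) x ≡ true
    lookup-∈ x<n x∈ = trans (lookupB-table a b x<n) x∈

  private
    count : ℕ → ℕ
    count n = countB (smallerSummand? a b n) (upTo n)

    ∈⇒count≡1 : ∀ {n} → InUlam a b n → n ≢ a → n ≢ b → count n ≡ 1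
    ∈⇒count≡1 {n} n∈ n≢a n≢b with n <ᵇ suc (a ⊔ b) | trans (sym (ulam?-unfold n≢a n≢b)) n∈
    ... | false | count≡ᵇ1 = ≡ᵇ⇒≡ (count n) 1 (subst T (sym count≡ᵇ1) _)

  ∈⇒split : ∀ {n} → InUlam a b n → n ≢ a → n ≢ b → Split a b n
  ∈⇒split {n} n∈ n≢a n≢b with countB-upTo-witness (smallerSummand? a b n) n (≤-reflexive (sym (∈⇒count≡1 n∈ n≢a n≢b)))
  ... | _ , _ , test = proj₁ (smallerSummand?-sound test)

  ∈⇒small-unique : ∀ {n} → InUlam a b n → n ≢ a → n ≢ b → (s t : Split a b n) → small s ≡ small t
  ∈⇒small-unique {n} n∈ n≢a n≢b s t = ≤-antisym (≮⇒≥ (not-below t s)) (≮⇒≥ (not-below s t))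
    where
    not-below : (s t : Split a b n) → ¬ small s < small t
    not-below s t lt = <-irrefl refl (≤-trans
      (countB-upTo-≥2 (smallerSummand? a b n) lt (small<sum t) (smallerSummand?-complete s) (smallerSummand?-complete t))
      (≤-reflexive (∈⇒count≡1 n∈ n≢a n≢b)))

  ∈-intro : ∀ {n} → a < n → b < n → (s : Split a b n) → (∀ t → small t ≡ small s) → InUlam a b n
  ∈-intro {n} a<n b<n s only = trans (ulam?-unfold (>⇒≢ a<n) (>⇒≢ b<n))
    (accept (dec-false (n <? suc (a ⊔ b)) (<⇒≱ (⊔-pres-<m a<n b<n) ∘ s≤s⁻¹))
            (countB-upTo-≡1 (smallerSummand? a b n) (small<sum s) (smallerSummand?-complete s) only′))
    where
    accept : ∀ {p k} → p ≡ false → k ≡ 1 → (if p then false else (k ≡ᵇ 1)) ≡ true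
    accept refl refl = refl
    only′ : ∀ {x} → x < n → smallerSummand? a b n x ≡ true → x ≡ small s
    only′ _ test with smallerSummand?-sound test
    ... | t , refl = only t

  ∈-intro-by-part : ∀ {n x y} → a < n → b < n → x ≢ y → InUlam a b x → InUlam a b y → x + y ≡ n →
                    (∀ (t : Split a b n) → IsPart t x) → InUlam a b n
  ∈-intro-by-part {n} {x} {y} a<n b<n x≢y x∈ y∈ x+y≡n all-x with <-cmp x y
  ... | tri< x<y _ _ = ∈-intro a<n b<n s (λ t → small-unique-by-part t s (all-x t) (inj₁ refl))
    where s = split x y x<y x+y≡n x∈ y∈
  ... | tri≈ _ x≡y _ = contradiction x≡y x≢y
  ... | tri> _ _ y<x = ∈-intro a<n b<n s (λ t → small-unique-by-part t s (all-x t) (inj₂ refl))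
    where s = split y x y<x (trans (+-comm y x) x+y≡n) y∈ x∈

  ∉-≤⊔ : ∀ {n} → n ≢ a → n ≢ b → n ≤ a ⊔ b → ¬ InUlam a b n
  ∉-≤⊔ {n} n≢a n≢b n≤a⊔b n∈ rewrite ulam?-unfold n≢a n≢b | <⇒<ᵇ-true (s≤s n≤a⊔b) with n∈
  ... | ()

  ∈⇒combination : ∀ n → InUlam a b n → ∃₂ λ s t → s * a + t * b ≡ n
  ∈⇒combination = <-rec _ combine
    where
    combine : ∀ n → (∀ {m} → m < n → InUlam a b m → ∃₂ λ s t → s * a + t * b ≡ m) →
              InUlam a b n → ∃₂ λ s t → s * a + t * b ≡ n
    combine n rec n∈ with n ≟ a | n ≟ b
    ... | yes refl | _        = 1 , 0 , trans (+-identityʳ _) (+-identityʳ n)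
    ... | no _     | yes refl = 0 , 1 , +-identityʳ n
    ... | no n≢a   | no n≢b
      with sp ← ∈⇒split n∈ n≢a n≢b
      with s₁ , t₁ , small≡ ← rec (small<sum sp) (small∈ sp)
         | s₂ , t₂ , large≡ ← rec (large<sum sp) (large∈ sp)
      = s₁ + s₂ , t₁ + t₂ , Coords.sum≡ {sp = sp} (coords s₁ t₁ s₂ t₂ small≡ large≡)

  split-coords : ∀ {n} (sp : Split a b n) → Coords sp
  split-coords sp with s₁ , t₁ , small≡ ← ∈⇒combination (small sp) (small∈ sp)
                     | s₂ , t₂ , large≡ ← ∈⇒combination (large sp) (large∈ sp)
    = coords s₁ t₁ s₂ t₂ small≡ large≡

module Multiples {a b : ℕ} (0<a : 0 < a) (0<b : 0 < b) (cop : Coprime a b) where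
  open Membership 0<a 0<b

  private instance
    b≢0 : NonZero b
    b≢0 = >-nonZero 0<b

  multiplier≡1 : ∀ {m t} → (∀ {z} → 2 ≤ z → z < m → ¬ InUlam a b (z * b)) →
                 t < m → InUlam a b (t * b) → t ≡ 1
  multiplier≡1 {t = zero}          _    _   0∈ = contradiction 0∈ (0∉ 0<a 0<b)
  multiplier≡1 {t = suc zero}      _    _   _  = refl
  multiplier≡1 {t = suc (suc _)}   none t<m t∈ = contradiction t∈ (none (s≤s (s≤s z≤n)) t<m)

  no-split-into-multiples : ∀ {m n} → (∀ {z} → 2 ≤ z → z < m → ¬ InUlam a b (z * b)) →
    (sp : Split a b n) (cs : Coords sp) → n ≡ m * b → Coords.s₁ cs + Coords.s₂ cs ≡ 0 → ⊥
  no-split-into-multiples {m} none sp cs@(coords s₁ t₁ s₂ t₂ small≡ large≡) n≡m*b s₁+s₂≡0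
    with refl ← m+n≡0⇒m≡0 s₁ s₁+s₂≡0 | refl ← m+n≡0⇒n≡0 s₁ s₁+s₂≡0
    = <-irrefl small≡large (small<large sp)
    where
    t₁+t₂≡m : t₁ + t₂ ≡ m
    t₁+t₂≡m = *-cancelʳ-≡ (t₁ + t₂) m b (trans (Coords.sum≡ cs) n≡m*b)
    positive : ∀ {t x} → t * b ≡ x → InUlam a b x → 0 < t
    positive {t} t*b≡x x∈ = *-cancelʳ-< b 0 t (subst (0 <_) (sym t*b≡x) (∈⇒>0 x∈))
    t₁≡1 : t₁ ≡ 1
    t₁≡1 = multiplier≡1 none (subst (t₁ <_) t₁+t₂≡m (m<m+n t₁ (positive large≡ (large∈ sp))))
             (subst (InUlam a b) (sym small≡) (small∈ sp))
    t₂≡1 : t₂ ≡ 1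
    t₂≡1 = multiplier≡1 none (subst (t₂ <_) t₁+t₂≡m (m<n+m t₂ (positive small≡ (small∈ sp))))
             (subst (InUlam a b) (sym large≡) (large∈ sp))
    small≡large : small sp ≡ large sp
    small≡large = trans (sym small≡) (trans (cong (_* b) (trans t₁≡1 (sym t₂≡1))) large≡)

  multiple-∉ : ∀ {j} → 2 ≤ j → j < a → ¬ InUlam a b (j * b)
  multiple-∉ {j} = <-rec (λ j → 2 ≤ j → j < a → ¬ InUlam a b (j * b)) below j
    where
    below : ∀ j → (∀ {z} → z < j → 2 ≤ z → z < a → ¬ InUlam a b (z * b)) →
            2 ≤ j → j < a → ¬ InUlam a b (j * b)
    below j rec 2≤j j<a j∈ = no-split-into-multiples (λ 2≤z z<j → rec z<j 2≤z (<-trans z<j j<a)) sp cs refl s≡0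
      where
      j*b≢a : j * b ≢ a
      j*b≢a j*b≡a with refl ← cop (subst (b ∣_) j*b≡a (n∣m*n j) , ∣-refl) =
        <-irrefl (trans (sym (*-identityʳ j)) j*b≡a) j<a
      j*b≢b : j * b ≢ b
      j*b≢b j*b≡b = <-irrefl (sym (*-cancelʳ-≡ j 1 b (trans j*b≡b (sym (*-identityˡ b))))) 2≤j
      sp = ∈⇒split j∈ j*b≢a j*b≢b
      cs = split-coords sp
      open Coords cs
      s<b : s₁ + s₂ < b
      s<b = *-cancelʳ-< a (s₁ + s₂) b (begin-strict
        (s₁ + s₂) * a                  ≤⟨ m≤m+n _ _ ⟩
        (s₁ + s₂) * a + (t₁ + t₂) * b  ≡⟨ sum≡ ⟩
        j * b                          <⟨ *-monoˡ-< b j<a ⟩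
        a * b                          ≡⟨ *-comm a b ⟩
        b * a                          ∎)
        where open ≤-Reasoning
      s≡0 : s₁ + s₂ ≡ 0
      s≡0 = coprime-coords {t = t₁ + t₂} {v = j} cop sum≡ s<b (≤-trans 0<b (m≤n+m b (s₁ + s₂)))

module Products {a b : ℕ} (2≤a : 2 ≤ a) (2≤b : 2 ≤ b) (cop : Coprime a b) where
  private
    0<a : 0 < a
    0<a = <-trans z<s 2≤a
    0<b : 0 < b
    0<b = <-trans z<s 2≤b
    instance
      a≢0 : NonZero a
      a≢0 = >-nonZero 0<a
      b≢0 : NonZero b
      b≢0 = >-nonZero 0<b
  open Membership 0<a 0<b
  private
    module ᵇ = Multiples 0<a 0<b cop
    module ᵃ = Multiples 0<b 0<a (Coprime-sym cop)

  product-∉ : ¬ InUlam a b (a * b)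
  product-∉ ab∈ = no-split (split-coords sp)
    where
    ab≢a : a * b ≢ a
    ab≢a e = <-irrefl (sym (*-cancelˡ-≡ b 1 a (trans e (sym (*-identityʳ a))))) 2≤b
    ab≢b : a * b ≢ b
    ab≢b e = <-irrefl (sym (*-cancelʳ-≡ a 1 b (trans e (sym (*-identityˡ b))))) 2≤a
    sp = ∈⇒split ab∈ ab≢a ab≢b
    no-split : Coords sp → ⊥
    no-split cs with Coords.s₁ cs + Coords.s₂ cs ≟ 0
    ... | yes s≡0 = ᵇ.no-split-into-multiples ᵇ.multiple-∉ sp cs refl s≡0
    ... | no  s≢0 = ᵃ.no-split-into-multiples ᵃ.multiple-∉ (Split-swap sp) (Coords-swap cs) (*-comm a b) t≡0
      where
      open Coords cs
      sum≡′ : (t₁ + t₂) * b + (s₁ + s₂) * a ≡ 0 * b + b * a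
      sum≡′ = trans (+-comm ((t₁ + t₂) * b) _) (trans sum≡ (*-comm a b))
      t<a : t₁ + t₂ < a
      t<a = *-cancelʳ-< b (t₁ + t₂) a (begin-strict
        (t₁ + t₂) * b                  <⟨ m<m+n _ (*-monoˡ-< a (n≢0⇒n>0 s≢0)) ⟩
        (t₁ + t₂) * b + (s₁ + s₂) * a  ≡⟨ sum≡′ ⟩
        b * a                          ≡⟨ *-comm b a ⟩
        a * b                          ∎)
        where open ≤-Reasoning
      t≡0 : t₁ + t₂ ≡ 0
      t≡0 = coprime-coords {t = s₁ + s₂} {v = b} (Coprime-sym cop) sum≡′ t<a (≤-trans 0<a (m≤n+m a _))

  multiple-∈⇒≡1 : ∀ {j} → j ≤ a → InUlam a b (j * b) → j ≡ 1
  multiple-∈⇒≡1 j≤a j∈ with m≤n⇒m<n∨m≡n j≤a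
  ... | inj₁ j<a  = ᵇ.multiplier≡1 ᵇ.multiple-∉ j<a j∈
  ... | inj₂ refl = contradiction j∈ product-∉

module AtLeastTwo {a b : ℕ} (2≤a : 2 ≤ a) (2≤b : 2 ≤ b) (a≢b : a ≢ b) (cop : Coprime a b) where
  private
    0<a : 0 < a
    0<a = <-trans z<s 2≤a
    0<b : 0 < b
    0<b = <-trans z<s 2≤b
    instance
      a≢0 : NonZero a
      a≢0 = >-nonZero 0<a
      b≢0 : NonZero b
      b≢0 = >-nonZero 0<b
  open Membership 0<a 0<b
  open Products 2≤a 2≤b cop
  private
    module ᵃ = Products 2≤b 2≤a (Coprime-sym cop)

  multiple-∈⇒≡b : ∀ {t x} → t * b ≡ x → t ≤ a → InUlam a b x → x ≡ b
  multiple-∈⇒≡b {t} refl t≤a x∈ = trans (cong (_* b) (multiple-∈⇒≡1 t≤a x∈)) (+-identityʳ b)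

  b-part : ∀ {n} (sp : Split a b n) (cs : Coords sp) →
           Coords.s₁ cs + Coords.s₂ cs ≡ 1 → Coords.t₁ cs + Coords.t₂ cs ≤ a → IsPart sp b
  b-part sp (coords zero t₁ s₂ t₂ small≡ _) _ t≤a =
    inj₁ (multiple-∈⇒≡b small≡ (≤-trans (m≤m+n t₁ t₂) t≤a) (small∈ sp))
  b-part sp (coords (suc s₁) t₁ s₂ t₂ _ large≡) s≡1 t≤a with refl ← m+n≡0⇒n≡0 s₁ (suc-injective s≡1) =
    inj₂ (multiple-∈⇒≡b large≡ (≤-trans (m≤n+m t₂ t₁) t≤a) (large∈ sp))

  b≢a+kb : ∀ k → b ≢ a + k * b
  b≢a+kb zero    b≡a+0 = a≢b (sym (trans b≡a+0 (+-identityʳ a)))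
  b≢a+kb (suc k) b≡a+kb = <-irrefl b≡a+kb (<-≤-trans (m<n+m b 0<a) (+-monoʳ-≤ a (m≤m+n b (k * b))))

  -- Coprimality forces the summed coordinates of any split of a + kb to be (1, k).
  a+kb-split-has-b : ∀ {k} → k < a → (sp : Split a b (a + k * b)) → IsPart sp b
  a+kb-split-has-b {k} k<a sp = b-part sp cs s≡1 (≤-trans (≤-reflexive t≡k) (<⇒≤ k<a))
    where
    cs = split-coords sp
    open Coords cs
    sum≡′ : (s₁ + s₂) * a + (t₁ + t₂) * b ≡ 1 * a + k * b
    sum≡′ = trans sum≡ (cong (_+ k * b) (sym (*-identityˡ a)))
    s<1+b : s₁ + s₂ < 1 + b
    s<1+b = *-cancelʳ-< a _ _ (begin-strict
      (s₁ + s₂) * a                  ≤⟨ m≤m+n _ _ ⟩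
      (s₁ + s₂) * a + (t₁ + t₂) * b  ≡⟨ sum≡ ⟩
      a + k * b                      <⟨ +-monoʳ-< a (subst (k * b <_) (*-comm a b) (*-monoˡ-< b k<a)) ⟩
      (1 + b) * a                    ∎)
      where open ≤-Reasoning
    s≡1 : s₁ + s₂ ≡ 1
    s≡1 = coprime-coords {t = t₁ + t₂} {v = k} cop sum≡′ s<1+b (≤-trans 2≤b (m≤n+m b _))
    t≡k : t₁ + t₂ ≡ k
    t≡k = combination-cancel sum≡′ s≡1

  a+kb-∈ : ∀ {k} → k < a → InUlam a b (a + k * b)
  a+kb-∈ {zero}  _     = subst (InUlam a b) (sym (+-identityʳ a)) (generator₁-∈ a b)
  a+kb-∈ {suc k} 1+k<a = ∈-intro-by-part a<n b<n (b≢a+kb k) (generator₂-∈ a b)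
                           (a+kb-∈ (<-trans (n<1+n k) 1+k<a)) b+m≡n (a+kb-split-has-b 1+k<a)
    where
    b+m≡n : b + (a + k * b) ≡ a + suc k * b
    b+m≡n = trans (sym (+-assoc b a (k * b))) (trans (cong (_+ k * b) (+-comm b a)) (+-assoc a b (k * b)))
    a<n : a < a + suc k * b
    a<n = m<m+n a (≤-trans 0<b (m≤m+n b (k * b)))
    b<n : b < a + suc k * b
    b<n = subst (b <_) b+m≡n (m<m+n b (≤-trans 0<a (m≤m+n a (k * b))))

  -- Coordinates (b + 1, 0) would split (b + 1)a into two multiples of a; the only
  -- other coordinates allowed by coprimality are (1, a).
  [1+b]a-split-has-b : (sp : Split a b ((b + 1) * a)) → IsPart sp b
  [1+b]a-split-has-b sp = by-coords (split-coords sp)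
    where
    module ᵃM = Multiples 0<b 0<a (Coprime-sym cop)
    no-a-multiples : ∀ {z} → 2 ≤ z → z < b + 1 → ¬ InUlam b a (z * a)
    no-a-multiples {z} 2≤z z<b+1 z∈ =
      <-irrefl (sym (ᵃ.multiple-∈⇒≡1 (≤-pred (subst (z <_) (+-comm b 1) z<b+1)) z∈)) 2≤z
    by-coords : Coords sp → IsPart sp b
    by-coords cs with Coords.t₁ cs + Coords.t₂ cs <? a
    ... | yes t<a = ⊥-elim (ᵃM.no-split-into-multiples no-a-multiples (Split-swap sp) (Coords-swap cs) refl t≡0)
      where
      open Coords cs
      t≡0 : t₁ + t₂ ≡ 0
      t≡0 = coprime-coords {t = s₁ + s₂} {v = b + 1} (Coprime-sym cop) (Coords.sum≡ (Coords-swap cs))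
              t<a (≤-trans 0<a (m≤n+m a _))
    ... | no t≮a = b-part sp cs s≡1 (≤-reflexive t≡a)
      where
      open Coords cs
      sum≡′ : (t₁ + t₂) * b + (s₁ + s₂) * a ≡ a * b + 1 * a
      sum≡′ = trans (Coords.sum≡ (Coords-swap cs)) (regroup b a)
        where
        regroup : ∀ b a → (b + 1) * a ≡ a * b + 1 * a
        regroup = solve-∀
      t<a+a : t₁ + t₂ < a + a
      t<a+a = *-cancelʳ-< b _ _ (begin-strict
        (t₁ + t₂) * b                  ≤⟨ m≤m+n _ _ ⟩
        (t₁ + t₂) * b + (s₁ + s₂) * a  ≡⟨ sum≡′ ⟩
        a * b + 1 * a                  <⟨ +-monoʳ-< (a * b) (subst (_< a * b) (sym (*-identityˡ a)) (m<m*n a b 2≤b)) ⟩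
        a * b + a * b                  ≡⟨ *-distribʳ-+ b a a ⟨
        (a + a) * b                    ∎)
        where open ≤-Reasoning
      t≡a : t₁ + t₂ ≡ a
      t≡a = coprime-coords {t = s₁ + s₂} {v = 1} (Coprime-sym cop) sum≡′ t<a+a
              (+-monoˡ-< a (<-≤-trans 0<a (≮⇒≥ t≮a)))
      s≡1 : s₁ + s₂ ≡ 1
      s≡1 = combination-cancel sum≡′ t≡a

  [1+b]a-∈ : InUlam a b ((b + 1) * a)
  [1+b]a-∈ = ∈-intro-by-part a<n b<n (<⇒≢ b<m) (generator₂-∈ a b) (a+kb-∈ (∸-monoʳ-< z<s 0<a)) b+m≡n
               [1+b]a-split-has-b
    where
    m : ℕ
    m = a + (a ∸ 1) * b
    b+m≡n : b + m ≡ (b + 1) * a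
    b+m≡n = begin
      b + (a + (a ∸ 1) * b)  ≡⟨ shift b a (a ∸ 1) ⟩
      a + (1 + (a ∸ 1)) * b  ≡⟨ cong (λ x → a + x * b) (m+[n∸m]≡n 0<a) ⟩
      a + a * b              ≡⟨ collect a b ⟩
      (b + 1) * a            ∎
      where
      open ≡-Reasoning
      shift : ∀ b a c → b + (a + c * b) ≡ a + (1 + c) * b
      shift = solve-∀
      collect : ∀ a b → a + a * b ≡ (b + 1) * a
      collect = solve-∀
    b<m : b < m
    b<m = +-mono-<-≤ 0<a (subst (_≤ (a ∸ 1) * b) (+-identityʳ b) (*-monoˡ-≤ b (∸-monoˡ-≤ 1 2≤a)))
    b<n : b < (b + 1) * a
    b<n = subst (b <_) b+m≡n (m<m+n b (<-trans 0<b b<m))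
    a<n : a < (b + 1) * a
    a<n = subst (a <_) b+m≡n (<-≤-trans (m<n+m a 0<b) (+-monoʳ-≤ b (m≤m+n a _)))

interval-∈ : ∀ {a k} → 2 ≤ a → k ≤ a → InUlam a 1 (a + k)
interval-∈ {a} {zero}  _   _     = subst (InUlam a 1) (sym (+-identityʳ a)) (generator₁-∈ a 1)
interval-∈ {a} {suc k} 2≤a 1+k≤a =
  ∈-intro-by-part a<n 1<n (<⇒≢ 1<a+k) (generator₂-∈ a 1) (interval-∈ 2≤a (≤-trans (n≤1+n k) 1+k≤a))
    (sym (+-suc a k)) has-1
  where
  open Membership (<-trans z<s 2≤a) z<s
  1<a+k : 1 < a + k
  1<a+k = ≤-trans 2≤a (m≤m+n a k)
  a<n : a < a + suc k
  a<n = m<m+n a z<s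
  1<n : 1 < a + suc k
  1<n = <-trans 1<a+k (+-monoʳ-< a (n<1+n k))
  has-1 : ∀ t → IsPart t 1
  has-1 t with small t ≟ 1
  ... | yes x≡1 = inj₁ x≡1
  ... | no  x≢1 = contradiction (small∈ t) (∉-≤⊔ (<⇒≢ x<a) x≢1 (≤-trans (<⇒≤ x<a) (m≤m⊔n a 1)))
    where
    x<a : small t < a
    x<a = ≰⇒> λ a≤x → <-irrefl refl (begin-strict
      a + a                  ≤⟨ +-mono-≤ a≤x a≤x ⟩
      small t + small t      <⟨ +-monoʳ-< (small t) (small<large t) ⟩
      small t + large t      ≡⟨ small+large t ⟩
      a + suc k              ≤⟨ +-monoʳ-≤ a 1+k≤a ⟩
      a + a                  ∎)
      where open ≤-Reasoning

small-multiple-of-a-∈ : ∀ {a b} → 0 < a → 0 < b → a ≢ b → Coprime a b →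
                        ∃ λ k → 2 ≤ k × k ≤ b + 1 × InUlam a b (k * a)
small-multiple-of-a-∈ {1} {1} _ _ 1≢1 _ = contradiction refl 1≢1
small-multiple-of-a-∈ {1} {b@(suc (suc _))} _ _ _ _ =
  b , s≤s (s≤s z≤n) , m≤m+n b 1 , subst (InUlam 1 b) (sym (*-identityʳ b)) (generator₂-∈ 1 b)
small-multiple-of-a-∈ {a@(suc (suc _))} {1} _ _ _ _ =
  2 , ≤-refl , ≤-refl , subst (InUlam a 1) (cong (a +_) (sym (+-identityʳ a))) (interval-∈ {k = a} (s≤s (s≤s z≤n)) ≤-refl)
small-multiple-of-a-∈ {a@(suc (suc _))} {b@(suc (suc _))} _ _ a≢b cop =
  b + 1 , s≤s (s≤s z≤n) , ≤-refl , AtLeastTwo.[1+b]a-∈ (s≤s (s≤s z≤n)) (s≤s (s≤s z≤n)) a≢b cop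

progression-stops-given-multiple : ∀ {a b c k i} → 0 < a → 0 < b → 2 ≤ k → k + i ≡ b + 1 → InUlam a b (k * a) →
  (b + 1) * a < c → (∀ i → i ≤ b → InUlam a b (c + i * a)) → ¬ InUlam a b (c + (b + 1) * a)
progression-stops-given-multiple {a} {b} {c} {k} {i} 0<a 0<b 2≤k k+i≡b+1 ka∈ [b+1]a<c progression n∈ =
  <-irrefl (∈⇒small-unique n∈ n≢a n≢b via-a via-ka) a<ka
  where
  open Membership 0<a 0<b
  instance
    a≢0 : NonZero a
    a≢0 = >-nonZero 0<a
  n : ℕ
  n = c + (b + 1) * a
  c≤n : c ≤ n
  c≤n = m≤m+n c _
  a<ka : a < k * a
  a<ka = <-≤-trans (m<m+n a (subst (0 <_) (sym (+-identityʳ a)) 0<a)) (*-monoˡ-≤ a 2≤k)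
  ka<c : k * a < c
  ka<c = ≤-<-trans (*-monoˡ-≤ a (m≤m+n k i)) (subst (λ m → m * a < c) (sym k+i≡b+1) [b+1]a<c)
  n≢a : n ≢ a
  n≢a = >⇒≢ (<-trans a<ka (<-≤-trans ka<c c≤n))
  n≢b : n ≢ b
  n≢b = >⇒≢ (<-≤-trans (<-≤-trans (m<m+n b z<s) (m≤m*n (b + 1) a)) (<⇒≤ (<-≤-trans [b+1]a<c c≤n)))
  i≤b : i ≤ b
  i≤b = <⇒≤ (s≤s⁻¹ (subst (2 + i ≤_) (trans k+i≡b+1 (+-comm b 1)) (+-monoˡ-≤ i 2≤k)))
  via-a : Split a b n
  via-a = split a (c + b * a) (<-trans a<ka (<-≤-trans ka<c (m≤m+n c _))) (shift a b c)
                (generator₁-∈ a b) (progression b ≤-refl)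
    where
    shift : ∀ a b c → a + (c + b * a) ≡ c + (b + 1) * a
    shift = solve-∀
  via-ka : Split a b n
  via-ka = split (k * a) (c + i * a) (<-≤-trans ka<c (m≤m+n c _))
                 (trans (regroup k i c a) (cong (λ m → c + m * a) k+i≡b+1)) ka∈ (progression i i≤b)
    where
    regroup : ∀ k i c a → k * a + (c + i * a) ≡ c + (k + i) * a
    regroup = solve-∀

progression-of-a-stops : ∀ {a b} → 0 < a → 0 < b → a ≢ b → Coprime a b → ∀ c → (b + 1) * a < c →
  (∀ i → i ≤ b → InUlam a b (c + i * a)) → ¬ InUlam a b (c + (b + 1) * a)
progression-of-a-stops 0<a 0<b a≢b cop c
  with k , 2≤k , k≤b+1 , ka∈ ← small-multiple-of-a-∈ 0<a 0<b a≢b cop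
  with i , k+i≡b+1 ← m≤n⇒∃[o]m+o≡n k≤b+1
  = progression-stops-given-multiple 0<a 0<b 2≤k k+i≡b+1 ka∈

theorem1p7 : (a b : ℕ) → 0 < a → 0 < b → a ≢ b → Coprime a b →
    ((c : ℕ) → (b + 1) * a < c → ((i : ℕ) → i ≤ b → InUlam a b (c + i * a)) → ¬ InUlam a b (c + (b + 1) * a))
    × ((c : ℕ) → b * (a + 1) < c → ((i : ℕ) → i ≤ a → InUlam a b (c + i * b)) → ¬ InUlam a b (c + (a + 1) * b))
theorem1p7 a b 0<a 0<b a≢b cop =
  progression-of-a-stops 0<a 0<b a≢b cop ,
  λ c b[a+1]<c progression n∈ →
    progression-of-a-stops 0<b 0<a (a≢b ∘ sym) (Coprime-sym cop) c (subst (_< c) (*-comm b (a + 1)) b[a+1]<c)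
      (λ i i≤a → InUlam-swap (c + i * b) (progression i i≤a)) (InUlam-swap (c + (a + 1) * b) n∈)
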